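{- Let $L$ be a normal strictly positive logic axiomatized over $\mathbf{K}^+$ by a set $S$ of sequent schemata, and let $L_D$ be its deep inference calculus. Then for all strictly positive formulas $A,B$: $A\vdash_L B$ if and only if $B$ is derivable from $A$ in $L_D$.
   Context: Fix a set $\Sigma$ of diamond modalities. Strictly positive formulas: $A::= p \mid \top \mid (A\land B)\mid aA$, $p$ a propositional variable, $a\in\Sigma$. The system $\mathbf{K}^+$ consists of: $A\vdash A$; $A\vdash\top$; from $A\vdash B$, $B\vdash C$ infer $A\vdash C$; $A\land B\vdash A$; $A\land B\vdash B$; from $A\vdash B$, $A\vdash C$ infer $A\vdash B\land C$; from $A\vdash B$ infer $aA\vdash aB$. The logic $L$ is the smallest set of sequents containing the axioms of $\mathbf{K}^+$ and all substitution instances of the sequents in $S$, and closed under the rules of $\mathbf{K}^+$; $A\vdash_L B$ means $A\vdash B\in L$. The deep inference calculus $L_D$ has the one-premise rules: from $A$ infer $A\land A$; from $A\land B$ infer $A$; from $A\land B$ infer $B$; from $A$ infer $\top$; and, for every (substitution instance of an) axiom $A\vdash B$ in $S$, from $A$ infer $B$. A context is a strictly positive formula $C(p)$ in which the variable $p$ occurs exactly once; $C(A)$ denotes the result of replacing that occurrence by $A$. If from $A$ infer $B$ is a rule instance and $C$ a context, then $C(B)$ is obtained from $C(A)$ by a rule application. A derivation of $B$ from $A$ in $L_D$ is a finite sequence of formulas starting with $A$ and ending with $B$ in which every member other than the first is obtained from the previous one by a rule application. -}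

module Defs where

open import Data.Nat using (ℕ)
open import Data.Product using (_×_; _,_)
open import Relation.Binary.Construct.Closure.ReflexiveTransitive using (Star)

data Fm (Σ' : Set) : Set where
  var  : ℕ → Fm Σ'
  ⊤'   : Fm Σ'
  _∧'_ : Fm Σ' → Fm Σ' → Fm Σ'
  ◇    : Σ' → Fm Σ' → Fm Σ'

Sequent : Set → Set
Sequent Σ' = Fm Σ' × Fm Σ'

subst : {Σ' : Set} → (ℕ → Fm Σ') → Fm Σ' → Fm Σ'
subst σ (var p)   = σ p
subst σ ⊤'        = ⊤'
subst σ (A ∧' B)  = subst σ A ∧' subst σ B
subst σ (◇ a A)   = ◇ a (subst σ A)

-- The logic L = K⁺ + S : smallest set of sequents containing the axioms
-- of K⁺ and all substitution instances of sequents in S, closed under the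
-- rules of K⁺.  A ⊢[ S ] B means A ⊢ B ∈ L.
data _⊢[_]_ {Σ' : Set} : Fm Σ' → (Sequent Σ' → Set) → Fm Σ' → Set₁ where
  ax   : ∀ {S A B} (σ : ℕ → Fm Σ') → S (A , B) → subst σ A ⊢[ S ] subst σ B
  refl : ∀ {S A} → A ⊢[ S ] A
  top  : ∀ {S A} → A ⊢[ S ] ⊤'
  cut  : ∀ {S A B C} → A ⊢[ S ] B → B ⊢[ S ] C → A ⊢[ S ] C
  ∧-l  : ∀ {S A B} → (A ∧' B) ⊢[ S ] A
  ∧-r  : ∀ {S A B} → (A ∧' B) ⊢[ S ] B
  ∧-I  : ∀ {S A B C} → A ⊢[ S ] B → A ⊢[ S ] C → A ⊢[ S ] (B ∧' C)
  mono : ∀ {S A B} (a : Σ') → A ⊢[ S ] B → ◇ a A ⊢[ S ] ◇ a B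

data Rule {Σ' : Set} (S : Sequent Σ' → Set) : Fm Σ' → Fm Σ' → Set where
  dup   : ∀ {A} → Rule S A (A ∧' A)
  projl : ∀ {A B} → Rule S (A ∧' B) A
  projr : ∀ {A B} → Rule S (A ∧' B) B
  tru   : ∀ {A} → Rule S A ⊤'
  axr   : ∀ {A B} (σ : ℕ → Fm Σ') → S (A , B) → Rule S (subst σ A) (subst σ B)

data Ctx (Σ' : Set) : Set where
  hole : Ctx Σ'
  _∧l_ : Ctx Σ' → Fm Σ' → Ctx Σ'
  _∧r_ : Fm Σ' → Ctx Σ' → Ctx Σ'
  ◇c   : Σ' → Ctx Σ' → Ctx Σ'

plug : {Σ' : Set} → Ctx Σ' → Fm Σ' → Fm Σ'
plug hole A       = A
plug (C ∧l B) A   = plug C A ∧' B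
plug (B ∧r C) A   = B ∧' plug C A
plug (◇c a C) A   = ◇ a (plug C A)

data Step {Σ' : Set} (S : Sequent Σ' → Set) : Fm Σ' → Fm Σ' → Set where
  step : ∀ {A B} (C : Ctx Σ') → Rule S A B → Step S (plug C A) (plug C B)

DerivableD : {Σ' : Set} → (Sequent Σ' → Set) → Fm Σ' → Fm Σ' → Set
DerivableD S A B = Star (Step S) A B

-- Both directions are inductions, organised around one idea: each side is
-- closed under placing its judgements inside a context.
--   * Completeness (⊢ ⇒ L_D).  Contexts compose, so a rule application
--     seen inside a further context is again a rule application, and whole
--     derivations can be lifted into a context (liftDerivation).
--     Then each rule of K⁺ is simulated: axioms, ⊤ and projections are single
--     rule applications, cut is concatenation of derivations, ∧-introduction
--     is duplication followed by rewriting each conjunct in place, and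
--     monotonicity of ◇a is lifting into the context ◇a[ ].
--   * Soundness (L_D ⇒ ⊢).  Every rule of L_D is a theorem of L
--     (ruleSound), theorems of L are preserved by contexts (contextSound),
--     and derivations are composed by cut.
module Submission where

open import Defs
open import Data.Product using (_×_; _,_)
open import Relation.Binary.PropositionalEquality using (_≡_; refl; cong; subst₂)
open import Relation.Binary.Construct.Closure.ReflexiveTransitive
  using (ε; _◅◅_; gmap; fold; return)

module _ {Σ' : Set} {S : Sequent Σ' → Set} where

  _⇒D_ : Fm Σ' → Fm Σ' → Set
  _⇒D_ = DerivableD S

  ruleDerivation : ∀ {A B} → Rule S A B → A ⇒D B
  ruleDerivation r = return (step hole r)

  _⊙_ : Ctx Σ' → Ctx Σ' → Ctx Σ'
  hole     ⊙ D = D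
  (C ∧l E) ⊙ D = (C ⊙ D) ∧l E
  (E ∧r C) ⊙ D = E ∧r (C ⊙ D)
  ◇c a C   ⊙ D = ◇c a (C ⊙ D)

  plug-⊙ : ∀ C D (A : Fm Σ') → plug (C ⊙ D) A ≡ plug C (plug D A)
  plug-⊙ hole     D A = refl
  plug-⊙ (C ∧l E) D A = cong (_∧' E) (plug-⊙ C D A)
  plug-⊙ (E ∧r C) D A = cong (E ∧'_) (plug-⊙ C D A)
  plug-⊙ (◇c a C) D A = cong (◇ a) (plug-⊙ C D A)

  liftStep : ∀ {A B} (C : Ctx Σ') → Step S A B → Step S (plug C A) (plug C B)
  liftStep C (step {A} {B} D r) =
    subst₂ (Step S) (plug-⊙ C D A) (plug-⊙ C D B) (step (C ⊙ D) r)

  liftDerivation : ∀ {A B} (C : Ctx Σ') → A ⇒D B → plug C A ⇒D plug C B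
  liftDerivation C = gmap (plug C) (liftStep C)

  complete : ∀ {A B} → A ⊢[ S ] B → A ⇒D B
  complete (ax σ s)   = ruleDerivation (axr σ s)
  complete refl       = ε
  complete top        = ruleDerivation tru
  complete (cut d e)  = complete d ◅◅ complete e
  complete ∧-l        = ruleDerivation projl
  complete ∧-r        = ruleDerivation projr
  complete {A} (∧-I {B = B} d e) =
    ruleDerivation dup
      ◅◅ liftDerivation (hole ∧l A) (complete d)
      ◅◅ liftDerivation (B ∧r hole) (complete e)
  complete (mono a d) = liftDerivation (◇c a hole) (complete d)

  ruleSound : ∀ {A B} → Rule S A B → A ⊢[ S ] B
  ruleSound dup       = ∧-I refl refl
  ruleSound projl     = ∧-l
  ruleSound projr     = ∧-r
  ruleSound tru       = top
  ruleSound (axr σ s) = ax σ s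

  contextSound : ∀ {A B} (C : Ctx Σ') → A ⊢[ S ] B → plug C A ⊢[ S ] plug C B
  contextSound hole     d = d
  contextSound (C ∧l E) d = ∧-I (cut ∧-l (contextSound C d)) ∧-r
  contextSound (E ∧r C) d = ∧-I ∧-l (cut ∧-r (contextSound C d))
  contextSound (◇c a C) d = mono a (contextSound C d)

  stepSound : ∀ {A B} → Step S A B → A ⊢[ S ] B
  stepSound (step C r) = contextSound C (ruleSound r)

  sound : ∀ {A B} → A ⇒D B → A ⊢[ S ] B
  sound = fold (λ A B → A ⊢[ S ] B) (λ s d → cut (stepSound s) d) refl

mainTheorem4 : (Σ' : Set) (S : Sequent Σ' → Set) (A B : Fm Σ') →
    (A ⊢[ S ] B → DerivableD S A B) × (DerivableD S A B → A ⊢[ S ] B)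
mainTheorem4 Σ' S A B = complete , sound
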